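{- Let $\ell,m$ be positive integers and $\mu\in\mathcal{P}^{\ell,\ell+m-1}$. Then $\mu\in\mathcal{P}^\ell(\Omega_m)$ if and only if for every $i\in[\ell]$: (i) if $\tilde\mu(i)>i$ then $\tilde\mu(\tilde\mu(i))>i$; and (ii) if $\tilde\mu(i)<i$ then $\tilde\mu(\tilde\mu(i))<i$.
   Context: $[n]=\{1,\dots,n\}$. A partition with $n$ parts is a weakly decreasing sequence $(\mu_1,\dots,\mu_n)$ of positive integers, identified with the function $[n]\to\mathbb{Z}^+$, $i\mapsto\mu_i=\mu(i)$. $\mathcal{P}^{n,k}$ is the set of partitions with exactly $n$ parts all at most $k$. $\tau_k(\lambda_1,\dots,\lambda_n)=(k+1-\lambda_n,\dots,k+1-\lambda_1)$. For $\mu=(\mu_1,\dots,\mu_{n})$ and $0<j\leq\mu_{n}$, $(\mu:j)=(\mu_1,\dots,\mu_n,j)$. Fix $m\in\mathbb{Z}^+$. Define $\mathcal{P}^1(\Omega_m)=\Omega_m=\{(j):1\leq j\leq m\}$, and for $\ell\geq2$: $\mathcal{P}^\ell_{\rm d}(\Omega_m)=\{(\nu:j)\in\mathcal{P}^{\ell,\ell+m-1}:\nu\in\mathcal{P}^{\ell-1}(\Omega_m),\ 1\leq j\leq\nu_{\ell-1}\}$ and $\mathcal{P}^\ell(\Omega_m)=\mathcal{P}^\ell_{\rm d}(\Omega_m)\cup\tau_{\ell+m-1}(\mathcal{P}^\ell_{\rm d}(\Omega_m))$. Let $t:[\ell]\times[\ell+m-1]\to[\ell]$ be $t(r,s)=s$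 if $s<r$, $t(r,s)=r$ if $r\leq s\leq m+r-1$, $t(r,s)=s-m+1$ if $s>m+r-1$; for $\mu\in\mathcal{P}^{\ell,\ell+m-1}$, $\tilde\mu:[\ell]\to[\ell]$ is $\tilde\mu(i)=t(i,\mu(i))$. -}

module Defs where

open import Data.Nat using (ℕ; zero; suc; _+_; _∸_; _≤_; _<_; _<ᵇ_; _≤ᵇ_)
open import Data.Bool using (if_then_else_)
open import Data.Vec using (Vec; []; _∷_; _∷ʳ_; last; reverse; map)
open import Data.Product using (_×_)

-- 1-based evaluation of a sequence: at μ i = μ_i for 1 ≤ i ≤ n (0 outside the range)
at : ∀ {n} → Vec ℕ n → ℕ → ℕ
at []       _             = 0
at (x ∷ xs) zero          = 0
at (x ∷ xs) (suc zero)    = x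
at (x ∷ xs) (suc (suc i)) = at xs (suc i)

-- μ ∈ 𝒫^{n,k}: n parts (length is the Vec index), each in [1,k], weakly decreasing
IsPart : (n k : ℕ) → Vec ℕ n → Set
IsPart n k μ =
  (∀ i → 1 ≤ i → i ≤ n → (1 ≤ at μ i) × (at μ i ≤ k)) ×
  (∀ i j → 1 ≤ i → i ≤ j → j ≤ n → at μ j ≤ at μ i)

τ : ∀ {n} → ℕ → Vec ℕ n → Vec ℕ n
τ k λs = reverse (map (λ x → suc k ∸ x) λs)

-- 𝒫^ℓ(Ω_m) (InP) and 𝒫^ℓ_d(Ω_m) (InPd), ℓ ≥ 1, defined mutually as in the paper
mutual
  data InPd (m : ℕ) : (ℓ : ℕ) → Vec ℕ ℓ → Set where
    ext : ∀ {l} {ν : Vec ℕ (suc l)} {j : ℕ} →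
          InP m (suc l) ν → 1 ≤ j → j ≤ last ν →
          IsPart (suc (suc l)) (suc (suc l) + m ∸ 1) (ν ∷ʳ j) →
          InPd m (suc (suc l)) (ν ∷ʳ j)

  data InP (m : ℕ) : (ℓ : ℕ) → Vec ℕ ℓ → Set where
    base  : ∀ {j} → 1 ≤ j → j ≤ m → InP m 1 (j ∷ [])
    fromD : ∀ {l} {μ : Vec ℕ (suc (suc l))} →
            InPd m (suc (suc l)) μ → InP m (suc (suc l)) μ
    fromτ : ∀ {l} {ν : Vec ℕ (suc (suc l))} →
            InPd m (suc (suc l)) ν → InP m (suc (suc l)) (τ (suc (suc l) + m ∸ 1) ν)

t : (m r s : ℕ) → ℕ
t m r s = if s <ᵇ r then s else (if s ≤ᵇ m + r ∸ 1 then r else s ∸ m + 1)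

tilde : ∀ {ℓ} → (m : ℕ) → Vec ℕ ℓ → ℕ → ℕ
tilde m μ i = t m i (at μ i)

module Submission where

-- Write m = n + 1 and f = at μ.  In this notation t(r,s) is s below the window
-- [r, r+n], r inside it, and s - n above it.  The proof has three parts.
--
-- 1. Reformulation.  The condition of the theorem at an index i is equivalent
--    to the "balance" condition on μ itself:
--      (a) if μ_i = n + x with x > i then μ_x > i,
--      (b) if μ_i < i then μ_{μ_i} < n + i.
-- 2. Closure properties of balance on [1, L], for partitions bounded by n + L:
--    it only depends on the values on [1, L] (locality), it always holds at
--    the last index of a one-step extension, and it is preserved by τ, since
--    τ pairs the value at i with the complementary value at L + 1 - i.
-- 3. Induction on ℓ.  Every element of 𝒫^ℓ(Ω_m) is balanced by (2).
--    Conversely a balanced μ either has μ_1 < n + ℓ, and then its prefix is a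
--    balanced member of 𝒫^{ℓ-1}(Ω_m), so μ ∈ 𝒫^ℓ_d(Ω_m); or μ_1 = n + ℓ,
--    and then balance at 1 gives μ_ℓ ≥ 2, so τμ falls in the first case and
--    μ = τ(τμ) ∈ 𝒫^ℓ(Ω_m).

open import Defs
open import Data.Nat using (ℕ; _+_; _∸_; _≤_; _<_; _>_)
open import Data.Vec using (Vec)
open import Data.Product using (_×_)
open import Function.Bundles using (_⇔_)

open import Data.Nat using (zero; suc; z≤n; s≤s; _<ᵇ_; _≤ᵇ_; _≤?_)
open import Data.Nat.Properties
open import Data.Nat.Tactic.RingSolver using (solve-∀)
open import Data.Bool using (Bool; true; false; T; if_then_else_)
open import Data.Empty using (⊥-elim)
open import Data.Product using (∃; _,_; proj₁; proj₂)
open import Data.Vec using ([]; _∷_; _∷ʳ_; last; reverse; map; initLast)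
open import Data.Vec.Properties using (reverse-∷)
open import Function.Bundles using (mk⇔; module Equivalence)
open import Relation.Nullary using (yes; no)
open import Relation.Binary.PropositionalEquality

open Equivalence using (to; from)

swap-< : ∀ {a b c d} → a + b ≡ c + d → a < c → d < b
swap-< e a<c = ≰⇒> λ b≤d → <-irrefl e (+-mono-<-≤ a<c b≤d)

complement-bounds : ∀ {a b K} → a + b ≡ suc K → (1 ≤ b) × (b ≤ K) → (1 ≤ a) × (a ≤ K)
complement-bounds {a} {b} {K} a+b≡ (1≤b , b≤K) =
    swap-< (trans (+-comm b a) (trans a+b≡ (sym (+-identityʳ (suc K))))) (s≤s b≤K)
  , ≤-pred (swap-< (trans (sym a+b≡) (+-comm a b)) 1≤b)

above-value : ∀ n s → n < s → n + (s ∸ suc n + 1) ≡ s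
above-value n s n<s = begin
  n + (s ∸ suc n + 1)  ≡⟨ cong (n +_) (+-comm (s ∸ suc n) 1) ⟩
  n + suc (s ∸ suc n)  ≡⟨ +-suc n _ ⟩
  suc n + (s ∸ suc n)  ≡⟨ m+[n∸m]≡n n<s ⟩
  s                    ∎
  where open ≡-Reasoning

part-bound : ∀ ℓ n → ℓ + suc n ∸ 1 ≡ n + ℓ
part-bound ℓ n = trans (cong (_∸ 1) (+-suc ℓ n)) (+-comm ℓ n)

if-true : ∀ {A : Set} {b : Bool} {x y : A} → b ≡ true → (if b then x else y) ≡ x
if-true refl = refl

if-false : ∀ {A : Set} {b : Bool} {x y : A} → b ≡ false → (if b then x else y) ≡ y
if-false refl = refl

data TCase (n r s : ℕ) : Set where
  below  : s < r → t (suc n) r s ≡ s → TCase n r s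
  inside : r ≤ s → s ≤ n + r → t (suc n) r s ≡ r → TCase n r s
  above  : (x : ℕ) → r < x → s ≡ n + x → t (suc n) r s ≡ x → TCase n r s

t-case : ∀ n r s → TCase n r s
t-case n r s with s <ᵇ r in lt
... | true = below (<ᵇ⇒< s r (subst T (sym lt) _)) (if-true lt)
... | false with s ≤ᵇ n + r in le
...   | true  = inside (≮⇒≥ λ s<r → subst T lt (<⇒<ᵇ s<r))
                       (≤ᵇ⇒≤ s (n + r) (subst T (sym le) _))
                       (trans (if-false lt) (if-true le))
...   | false = above (s ∸ suc n + 1) r<x (sym x-value)
                      (trans (if-false lt) (if-false le))
  where
  n+r<s : n + r < s
  n+r<s = ≰⇒> λ s≤n+r → subst T le (≤⇒≤ᵇ s≤n+r)
  x-value : n + (s ∸ suc n + 1) ≡ s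
  x-value = above-value n s (≤-<-trans (m≤m+n n r) n+r<s)
  r<x : r < s ∸ suc n + 1
  r<x = +-cancelˡ-< n r _ (subst (n + r <_) (sym x-value) n+r<s)

T̃ : ℕ → (ℕ → ℕ) → ℕ → ℕ
T̃ n f i = t (suc n) i (f i)

TildeAt : ℕ → (ℕ → ℕ) → ℕ → Set
TildeAt n f i = (T̃ n f i > i → T̃ n f (T̃ n f i) > i) × (T̃ n f i < i → T̃ n f (T̃ n f i) < i)

BalancedAt : ℕ → (ℕ → ℕ) → ℕ → Set
BalancedAt n f i = (∀ x → f i ≡ n + x → i < x → i < f x) × (f i < i → f (f i) < n + i)

tilde-below : ∀ n f {i s} → s < i → (T̃ n f s < i ⇔ f s < n + i)
tilde-below n f {i} {s} s<i with t-case n s (f s)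
... | below fs<s e = mk⇔ (λ _ → <-≤-trans (<-trans fs<s s<i) (m≤n+m i n))
                         (λ _ → subst (_< i) (sym e) (<-trans fs<s s<i))
... | inside _ fs≤n+s e = mk⇔ (λ _ → ≤-<-trans fs≤n+s (+-monoʳ-< n s<i))
                              (λ _ → subst (_< i) (sym e) s<i)
... | above x _ fs≡n+x e =
  mk⇔ (λ T̃s<i → subst (_< n + i) (sym fs≡n+x) (+-monoʳ-< n (subst (_< i) e T̃s<i)))
      (λ fs<n+i → subst (_< i) (sym e) (+-cancelˡ-< n x i (subst (_< n + i) fs≡n+x fs<n+i)))

tilde-above : ∀ n f {i x} → i < x → (i < T̃ n f x ⇔ i < f x)
tilde-above n f {i} {x} i<x with t-case n x (f x)
... | below _ e = mk⇔ (subst (i <_) e) (subst (i <_) (sym e))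
... | inside x≤fx _ e = mk⇔ (λ _ → <-≤-trans i<x x≤fx) (λ _ → subst (i <_) (sym e) i<x)
... | above y x<y fx≡n+y e =
  mk⇔ (λ _ → subst (i <_) (sym fx≡n+y) (<-≤-trans (<-trans i<x x<y) (m≤n+m y n)))
      (λ _ → subst (i <_) (sym e) (<-trans i<x x<y))

balanced⇔tilde : ∀ n f i → BalancedAt n f i ⇔ TildeAt n f i
balanced⇔tilde n f i with t-case n i (f i)
... | below fi<i e =
  mk⇔ (λ (_ , b) → (λ i<T̃i → ⊥-elim (<-asym fi<i (subst (i <_) e i<T̃i)))
                 , (λ _ → subst (λ v → T̃ n f v < i) (sym e) (from (tilde-below n f fi<i) (b fi<i))))
      (λ (_ , c) → (λ x fi≡n+x i<x → ⊥-elim (<-asym fi<i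
                       (subst (i <_) (sym fi≡n+x) (<-≤-trans i<x (m≤n+m x n)))))
                 , (λ _ → to (tilde-below n f fi<i)
                       (subst (λ v → T̃ n f v < i) e (c (subst (_< i) (sym e) fi<i)))))
... | inside i≤fi fi≤n+i e =
  mk⇔ (λ _ → (λ i<T̃i → ⊥-elim (n≮n i (subst (i <_) e i<T̃i)))
           , (λ T̃i<i → ⊥-elim (n≮n i (subst (_< i) e T̃i<i))))
      (λ _ → (λ x fi≡n+x i<x → ⊥-elim
                 (<⇒≱ (+-monoʳ-< n i<x) (subst (_≤ n + i) fi≡n+x fi≤n+i)))
           , (λ fi<i → ⊥-elim (<⇒≱ fi<i i≤fi)))
... | above x i<x fi≡n+x e =
  mk⇔ (λ (b , _) → (λ _ → subst (λ v → i < T̃ n f v) (sym e)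
                            (from (tilde-above n f i<x) (b x fi≡n+x i<x)))
                 , (λ T̃i<i → ⊥-elim (<-asym i<x (subst (_< i) e T̃i<i))))
      (λ (c , _) → (λ x' fi≡n+x' i<x' →
                        subst (λ v → i < f v) (+-cancelˡ-≡ n x x' (trans (sym fi≡n+x) fi≡n+x'))
                          (to (tilde-above n f i<x)
                            (subst (λ v → i < T̃ n f v) e (c (subst (i <_) (sym e) i<x)))))
                 , (λ fi<i → ⊥-elim (<-asym fi<i
                       (subst (i <_) (sym fi≡n+x) (<-≤-trans i<x (m≤n+m x n))))))

Balanced : ℕ → ℕ → (ℕ → ℕ) → Set
Balanced n L f = ∀ i → 1 ≤ i → i ≤ L → BalancedAt n f i

Bounded : ℕ → ℕ → (ℕ → ℕ) → Set
Bounded K L f = ∀ i → 1 ≤ i → i ≤ L → (1 ≤ f i) × (f i ≤ K)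

Agree : ℕ → (ℕ → ℕ) → (ℕ → ℕ) → Set
Agree L f g = ∀ j → 1 ≤ j → j ≤ L → f j ≡ g j

balanced-local : ∀ n L {f g} → Bounded (n + L) L f → Agree L f g →
                 Balanced n L f → Balanced n L g
balanced-local n L {f} {g} bounded agree balanced i 1≤i i≤L = away , back
  where
  fi≡gi : f i ≡ g i
  fi≡gi = agree i 1≤i i≤L
  away : ∀ x → g i ≡ n + x → i < x → i < g x
  away x gi≡n+x i<x = subst (i <_) (agree x 1≤x x≤L) (proj₁ (balanced i 1≤i i≤L) x fi≡n+x i<x)
    where
    fi≡n+x : f i ≡ n + x
    fi≡n+x = trans fi≡gi gi≡n+x
    1≤x : 1 ≤ x
    1≤x = ≤-trans 1≤i (<⇒≤ i<x)
    x≤L : x ≤ L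
    x≤L = +-cancelˡ-≤ n x L (subst (_≤ n + L) fi≡n+x (proj₂ (bounded i 1≤i i≤L)))
  back : g i < i → g (g i) < n + i
  back gi<i = subst (λ v → g v < n + i) fi≡gi
                (subst (_< n + i) (agree (f i) (proj₁ (bounded i 1≤i i≤L)) fi≤L)
                  (proj₂ (balanced i 1≤i i≤L) fi<i))
    where
    fi<i : f i < i
    fi<i = subst (_< i) (sym fi≡gi) gi<i
    fi≤L : f i ≤ L
    fi≤L = <⇒≤ (<-≤-trans fi<i i≤L)

-- The index L + 1 is balanced as soon as f (L + 1) ≤ n + L + 1 and f ≤ n + L on [1, L]:
-- (a) is vacuous, and in (b) the value f (L + 1) lies in [1, L].
balancedAt-next : ∀ n L f → 1 ≤ f (suc L) → f (suc L) ≤ n + suc L →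
                  Bounded (n + L) L f → BalancedAt n f (suc L)
balancedAt-next n L f 1≤f f≤ bounded = away , back
  where
  away : ∀ x → f (suc L) ≡ n + x → suc L < x → suc L < f x
  away x f≡n+x L<x = ⊥-elim (<⇒≱ (+-monoʳ-< n L<x) (subst (_≤ n + suc L) f≡n+x f≤))
  back : f (suc L) < suc L → f (f (suc L)) < n + suc L
  back f<L = subst (f (f (suc L)) <_) (sym (+-suc n L))
                (s≤s (proj₂ (bounded _ 1≤f (≤-pred f<L))))

Mirror : ℕ → ℕ → (ℕ → ℕ) → (ℕ → ℕ) → Set
Mirror K L f g = ∀ i i' → 1 ≤ i → 1 ≤ i' → i + i' ≡ suc L → g i + f i' ≡ suc K

mirror-index : ∀ {L i} → 1 ≤ i → i ≤ L → ∃ λ i' → (1 ≤ i') × (i' ≤ L) × (i + i' ≡ suc L)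
mirror-index {L} {i} 1≤i i≤L =
  suc L ∸ i , m<n⇒0<n∸m (s≤s i≤L) , ∸-monoʳ-≤ (suc L) 1≤i , m+[n∸m]≡n (≤-trans i≤L (n≤1+n L))

rearrange : ∀ n a b → n + (a + b) ≡ (n + b) + a
rearrange = solve-∀

regroup : ∀ n a b → n + (a + b) ≡ a + (n + b)
regroup = solve-∀

-- Mirroring exchanges the two halves of balance: for a mirror pair i + i' = L + 1,
-- condition (a) for g at i follows from (b) for f at i', and (b) for g at i from (a) for f at i'.
module MirrorPair (n L : ℕ) {f g : ℕ → ℕ}
                  (bounded : Bounded (n + L) L f) (mirror : Mirror (n + L) L f g)
                  (balanced : Balanced n L f)
                  {i i' : ℕ} (1≤i : 1 ≤ i) (1≤i' : 1 ≤ i') (i'≤L : i' ≤ L) (i+i'≡ : i + i' ≡ suc L) where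

  sum : ∀ {a b} → 1 ≤ a → 1 ≤ b → a + b ≡ i + i' → g a + f b ≡ n + (i + i')
  sum 1≤a 1≤b a+b≡ = trans (mirror _ _ 1≤a 1≤b (trans a+b≡ i+i'≡))
                           (trans (sym (+-suc n L)) (cong (n +_) (sym i+i'≡)))

  away : ∀ x → g i ≡ n + x → i < x → i < g x
  away x gi≡n+x i<x =
    swap-< (trans (+-comm (f (f i')) (g x)) (trans (sum 1≤x 1≤fi' x+fi'≡) (rearrange n i i')))
           (proj₂ (balanced i' 1≤i' i'≤L) fi'<i')
    where
    1≤x : 1 ≤ x
    1≤x = ≤-trans 1≤i (<⇒≤ i<x)
    1≤fi' : 1 ≤ f i'
    1≤fi' = proj₁ (bounded i' 1≤i' i'≤L)
    x+fi'≡ : x + f i' ≡ i + i'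
    x+fi'≡ = +-cancelˡ-≡ n _ _ (trans (sym (+-assoc n x (f i')))
               (trans (cong (_+ f i') (sym gi≡n+x)) (sum 1≤i 1≤i' refl)))
    fi'<i' : f i' < i'
    fi'<i' = swap-< (sym x+fi'≡) i<x

  back : g i < i → g (g i) < n + i
  back gi<i = swap-< (trans (sym (regroup n i' i)) (trans (cong (n +_) (+-comm i' i))
                       (trans (sym (sum 1≤gi 1≤x gi+x≡)) (+-comm (g (g i)) (f x)))))
                     i'<fx
    where
    n+i'<fi' : n + i' < f i'
    n+i'<fi' = swap-< (trans (sum 1≤i 1≤i' refl) (regroup n i i')) gi<i
    x : ℕ
    x = f i' ∸ n
    fi'≡n+x : f i' ≡ n + x
    fi'≡n+x = sym (m+[n∸m]≡n (≤-trans (m≤m+n n i') (<⇒≤ n+i'<fi')))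
    i'<x : i' < x
    i'<x = +-cancelˡ-< n i' x (subst (n + i' <_) fi'≡n+x n+i'<fi')
    1≤x : 1 ≤ x
    1≤x = ≤-trans 1≤i' (<⇒≤ i'<x)
    i'<fx : i' < f x
    i'<fx = proj₁ (balanced i' 1≤i' i'≤L) x fi'≡n+x i'<x
    gi+x≡ : g i + x ≡ i + i'
    gi+x≡ = +-cancelˡ-≡ n _ _ (trans (regroup n (g i) x)
              (trans (cong (g i +_) (sym fi'≡n+x)) (sum 1≤i 1≤i' refl)))
    x<i+i' : x < i + i'
    x<i+i' = subst (x <_) (sym i+i'≡)
               (s≤s (+-cancelˡ-≤ n x L (subst (_≤ n + L) fi'≡n+x (proj₂ (bounded i' 1≤i' i'≤L)))))
    1≤gi : 1 ≤ g i
    1≤gi = swap-< (trans (+-comm x (g i)) (trans gi+x≡ (sym (+-identityʳ _)))) x<i+i'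

balanced-mirror : ∀ n L {f g} → Bounded (n + L) L f → Mirror (n + L) L f g →
                  Balanced n L f → Balanced n L g
balanced-mirror n L bounded mirror balanced i 1≤i i≤L with mirror-index 1≤i i≤L
... | i' , 1≤i' , i'≤L , i+i'≡ = away , back
  where open MirrorPair n L bounded mirror balanced 1≤i 1≤i' i'≤L i+i'≡

at-∷ʳ-init : ∀ {ℓ} (v : Vec ℕ ℓ) j i → 1 ≤ i → i ≤ ℓ → at (v ∷ʳ j) i ≡ at v i
at-∷ʳ-init (x ∷ v) j (suc zero)    _ _       = refl
at-∷ʳ-init (x ∷ v) j (suc (suc i)) _ (s≤s h) = at-∷ʳ-init v j (suc i) (s≤s z≤n) h

at-∷ʳ-last : ∀ {ℓ} (v : Vec ℕ ℓ) j → at (v ∷ʳ j) (suc ℓ) ≡ j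
at-∷ʳ-last []          j = refl
at-∷ʳ-last (x ∷ [])    j = refl
at-∷ʳ-last (x ∷ y ∷ v) j = at-∷ʳ-last (y ∷ v) j

last≡at : ∀ {ℓ} (v : Vec ℕ (suc ℓ)) → last v ≡ at v (suc ℓ)
last≡at (x ∷ [])    = refl
last≡at (x ∷ y ∷ v) = last≡at (y ∷ v)

at-reverse : ∀ {ℓ} (v : Vec ℕ ℓ) i i' → 1 ≤ i → 1 ≤ i' → i + i' ≡ suc ℓ →
             at (reverse v) i ≡ at v i'
at-reverse [] (suc i) (suc i') _ _ e =
  ⊥-elim (1+n≢0 (suc-injective (trans (sym (+-suc (suc i) i')) e)))
at-reverse (x ∷ v) i (suc zero) _ _ e rewrite reverse-∷ x v
  | suc-injective (trans (sym (+-comm i 1)) e) = at-∷ʳ-last (reverse v) x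
at-reverse {suc ℓ} (x ∷ v) i (suc (suc i')) 1≤i _ e rewrite reverse-∷ x v =
  trans (at-∷ʳ-init (reverse v) x i 1≤i i≤ℓ) (at-reverse v i (suc i') 1≤i (s≤s z≤n) e')
  where
  e' : i + suc i' ≡ suc ℓ
  e' = suc-injective (trans (sym (+-suc i (suc i'))) e)
  i≤ℓ : i ≤ ℓ
  i≤ℓ = ≤-trans (m≤m+n i i') (≤-pred (≤-reflexive (trans (sym (+-suc i i')) e')))

at-map : ∀ {ℓ} (g : ℕ → ℕ) (v : Vec ℕ ℓ) i → 1 ≤ i → i ≤ ℓ → at (map g v) i ≡ g (at v i)
at-map g (x ∷ v) (suc zero)    _ _       = refl
at-map g (x ∷ v) (suc (suc i)) _ (s≤s h) = at-map g v (suc i) (s≤s z≤n) h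

at-ext : ∀ {ℓ} (u v : Vec ℕ ℓ) → Agree ℓ (at u) (at v) → u ≡ v
at-ext []      []      _     = refl
at-ext (x ∷ u) (y ∷ v) agree = cong₂ _∷_ (agree 1 (s≤s z≤n) (s≤s z≤n))
  (at-ext u v (λ { (suc i) _ i≤ℓ → agree (suc (suc i)) (s≤s z≤n) (s≤s i≤ℓ) }))

τ-mirror : ∀ {ℓ} K (μ : Vec ℕ ℓ) → Bounded K ℓ (at μ) → Mirror K ℓ (at μ) (at (τ K μ))
τ-mirror {ℓ} K μ bounded i i' 1≤i 1≤i' i+i'≡ = begin
  at (reverse (map (suc K ∸_) μ)) i + at μ i'
    ≡⟨ cong (_+ at μ i') (at-reverse (map (suc K ∸_) μ) i i' 1≤i 1≤i' i+i'≡) ⟩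
  at (map (suc K ∸_) μ) i' + at μ i'
    ≡⟨ cong (_+ at μ i') (at-map (suc K ∸_) μ i' 1≤i' i'≤ℓ) ⟩
  (suc K ∸ at μ i') + at μ i'
    ≡⟨ m∸n+n≡m (≤-trans (proj₂ (bounded i' 1≤i' i'≤ℓ)) (n≤1+n K)) ⟩
  suc K ∎
  where
  open ≡-Reasoning
  i'≤ℓ : i' ≤ ℓ
  i'≤ℓ = ≤-pred (≤-trans (+-monoˡ-≤ i' 1≤i) (≤-reflexive i+i'≡))

mirror-bounded : ∀ {K L f g} → Bounded K L f → Mirror K L f g → Bounded K L g
mirror-bounded bounded mirror i 1≤i i≤L with mirror-index 1≤i i≤L
... | i' , 1≤i' , i'≤L , i+i'≡ =
  complement-bounds (mirror i i' 1≤i 1≤i' i+i'≡) (bounded i' 1≤i' i'≤L)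

mirror-IsPart : ∀ {ℓ K} (μ ρ : Vec ℕ ℓ) → IsPart ℓ K μ → Mirror K ℓ (at μ) (at ρ) → IsPart ℓ K ρ
mirror-IsPart {ℓ} {K} μ ρ (bounded , decreasing) mirror = bounded′ , decreasing′
  where
  bounded′ : Bounded K ℓ (at ρ)
  bounded′ = mirror-bounded bounded mirror
  decreasing′ : ∀ i j → 1 ≤ i → i ≤ j → j ≤ ℓ → at ρ j ≤ at ρ i
  decreasing′ i j 1≤i i≤j j≤ℓ
    with mirror-index 1≤i (≤-trans i≤j j≤ℓ) | mirror-index (≤-trans 1≤i i≤j) j≤ℓ
  ... | i' , 1≤i' , i'≤ℓ , i+i'≡ | j' , 1≤j' , j'≤ℓ , j+j'≡ =
    +-cancelʳ-≤ (at μ i') (at ρ j) (at ρ i)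
      (≤-trans (+-monoʳ-≤ (at ρ j) (decreasing j' i' 1≤j' j'≤i' i'≤ℓ))
        (≤-reflexive (trans (mirror j j' (≤-trans 1≤i i≤j) 1≤j' j+j'≡)
                            (sym (mirror i i' 1≤i 1≤i' i+i'≡)))))
    where
    j'≤i' : j' ≤ i'
    j'≤i' = +-cancelˡ-≤ i j' i' (≤-trans (+-monoˡ-≤ j' i≤j)
              (≤-reflexive (trans j+j'≡ (sym i+i'≡))))

τ-involutive : ∀ {ℓ} K (μ : Vec ℕ ℓ) → Bounded K ℓ (at μ) → τ K (τ K μ) ≡ μ
τ-involutive {ℓ} K μ bounded = at-ext (τ K (τ K μ)) μ entry
  where
  μ∣τμ : Mirror K ℓ (at μ) (at (τ K μ))
  μ∣τμ = τ-mirror K μ bounded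
  τμ∣ττμ : Mirror K ℓ (at (τ K μ)) (at (τ K (τ K μ)))
  τμ∣ττμ = τ-mirror K (τ K μ) (mirror-bounded bounded μ∣τμ)
  entry : Agree ℓ (at (τ K (τ K μ))) (at μ)
  entry i 1≤i i≤ℓ with mirror-index 1≤i i≤ℓ
  ... | i' , 1≤i' , _ , i+i'≡ = +-cancelʳ-≡ (at (τ K μ) i') _ _ (begin
    at (τ K (τ K μ)) i + at (τ K μ) i'  ≡⟨ τμ∣ττμ i i' 1≤i 1≤i' i+i'≡ ⟩
    suc K                               ≡⟨ sym (μ∣τμ i' i 1≤i' 1≤i (trans (+-comm i' i) i+i'≡)) ⟩
    at (τ K μ) i' + at μ i              ≡⟨ +-comm (at (τ K μ) i') (at μ i) ⟩
    at μ i + at (τ K μ) i'              ∎)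
    where open ≡-Reasoning

bounded-local : ∀ {K L f g} → Bounded K L f → Agree L f g → Bounded K L g
bounded-local bounded agree i 1≤i i≤L =
  subst (λ v → (1 ≤ v) × (v ≤ _)) (agree i 1≤i i≤L) (bounded i 1≤i i≤L)

∷ʳ-agree : ∀ {ℓ} (v : Vec ℕ ℓ) j → Agree ℓ (at v) (at (v ∷ʳ j))
∷ʳ-agree v j i 1≤i i≤ℓ = sym (at-∷ʳ-init v j i 1≤i i≤ℓ)

part-bounded : ∀ {ℓ n} (μ : Vec ℕ ℓ) → IsPart ℓ (ℓ + suc n ∸ 1) μ → Bounded (n + ℓ) ℓ (at μ)
part-bounded {ℓ} {n} μ P = subst (λ K → Bounded K ℓ (at μ)) (part-bound ℓ n) (proj₁ P)

singleton-IsPart : ∀ {K j} → 1 ≤ j → j ≤ K → IsPart 1 K (j ∷ [])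
singleton-IsPart 1≤j j≤K =
    (λ { (suc zero) _ _ → 1≤j , j≤K ; (suc (suc _)) _ (s≤s ()) })
  , (λ { (suc zero) (suc zero) _ _ _ → ≤-refl
       ; _ (suc (suc _)) _ _ (s≤s ())
       ; (suc (suc _)) (suc zero) _ (s≤s ()) _ })

prefix-IsPart : ∀ {ℓ K K'} (ν : Vec ℕ ℓ) j → IsPart (suc ℓ) K (ν ∷ʳ j) →
                at (ν ∷ʳ j) 1 ≤ K' → IsPart ℓ K' ν
prefix-IsPart {ℓ} {K} {K'} ν j (bounded , decreasing) μ₁≤K' = bounded′ , decreasing′
  where
  agree : Agree ℓ (at ν) (at (ν ∷ʳ j))
  agree = ∷ʳ-agree ν j
  bounded′ : Bounded K' ℓ (at ν)
  bounded′ i 1≤i i≤ℓ = subst (λ v → (1 ≤ v) × (v ≤ K')) (sym (agree i 1≤i i≤ℓ))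
    ( proj₁ (bounded i 1≤i (≤-trans i≤ℓ (n≤1+n _)))
    , ≤-trans (decreasing 1 i ≤-refl 1≤i (≤-trans i≤ℓ (n≤1+n _))) μ₁≤K')
  decreasing′ : ∀ i k → 1 ≤ i → i ≤ k → k ≤ ℓ → at ν k ≤ at ν i
  decreasing′ i k 1≤i i≤k k≤ℓ =
    subst₂ _≤_ (sym (agree k (≤-trans 1≤i i≤k) k≤ℓ)) (sym (agree i 1≤i (≤-trans i≤k k≤ℓ)))
      (decreasing i k 1≤i i≤k (≤-trans k≤ℓ (n≤1+n _)))

InP⇒IsPart : ∀ {m ℓ μ} → InP m ℓ μ → IsPart ℓ (ℓ + m ∸ 1) μ
InP⇒IsPart (base 1≤j j≤m) = singleton-IsPart 1≤j j≤m
InP⇒IsPart (fromD (ext _ _ _ P)) = P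
InP⇒IsPart (fromτ {ν = ν} (ext _ _ _ P)) = mirror-IsPart ν (τ _ ν) P (τ-mirror _ ν (proj₁ P))

mutual
  InP⇒balanced : ∀ {n ℓ μ} → InP (suc n) ℓ μ → Balanced n ℓ (at μ)
  InP⇒balanced {n} (base {j} 1≤j j≤m) (suc zero) _ _ =
    balancedAt-next n 0 (at (j ∷ [])) 1≤j (subst (j ≤_) (+-comm 1 n) j≤m) (λ { (suc _) _ () })
  InP⇒balanced (base _ _) (suc (suc _)) _ (s≤s ())
  InP⇒balanced (fromD d) = InPd⇒balanced d
  InP⇒balanced {n} (fromτ {l} {ν} d) =
    balanced-mirror n L (part-bounded ν P) mirror (InPd⇒balanced d)
    where
    L K : ℕ
    L = suc (suc l)
    K = L + suc n ∸ 1
    P : IsPart L K ν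
    P = InP⇒IsPart (fromD d)
    mirror : Mirror (n + L) L (at ν) (at (τ K ν))
    mirror = subst (λ K′ → Mirror K′ L (at ν) (at (τ K ν))) (part-bound L n)
                   (τ-mirror K ν (proj₁ P))

  InPd⇒balanced : ∀ {n ℓ μ} → InPd (suc n) ℓ μ → Balanced n ℓ (at μ)
  InPd⇒balanced {n} (ext {l} {ν} {j} ν∈ _ _ P) i 1≤i i≤L with i ≤? suc l
  ... | yes i≤l = balanced-local n (suc l) νbounded (∷ʳ-agree ν j) (InP⇒balanced ν∈) i 1≤i i≤l
    where
    νbounded : Bounded (n + suc l) (suc l) (at ν)
    νbounded = part-bounded ν (InP⇒IsPart ν∈)
  ... | no i≰l with ≤-antisym i≤L (≰⇒> i≰l)
  ...   | refl = balancedAt-next n (suc l) (at (ν ∷ʳ j)) (proj₁ μL-bounds) (proj₂ μL-bounds)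
                   prefix-bounded
    where
    μL-bounds : (1 ≤ at (ν ∷ʳ j) i) × (at (ν ∷ʳ j) i ≤ n + i)
    μL-bounds = part-bounded (ν ∷ʳ j) P i 1≤i i≤L
    prefix-bounded : Bounded (n + suc l) (suc l) (at (ν ∷ʳ j))
    prefix-bounded = bounded-local (part-bounded ν (InP⇒IsPart ν∈)) (∷ʳ-agree ν j)

snoc-InPd : ∀ n l (μ : Vec ℕ (suc (suc l))) → IsPart (suc (suc l)) (suc (suc l) + suc n ∸ 1) μ →
            Balanced n (suc (suc l)) (at μ) → at μ 1 ≤ suc l + suc n ∸ 1 →
            (∀ ν → IsPart (suc l) (suc l + suc n ∸ 1) ν → Balanced n (suc l) (at ν) →
                   InP (suc n) (suc l) ν) →
            InPd (suc n) (suc (suc l)) μ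
snoc-InPd n l μ P balanced μ₁≤ induction with initLast μ
... | ν , j , refl = ext (induction ν Pν νbalanced) 1≤j j≤last P
  where
  Pν : IsPart (suc l) (suc l + suc n ∸ 1) ν
  Pν = prefix-IsPart ν j P μ₁≤
  agree : Agree (suc l) (at ν) (at (ν ∷ʳ j))
  agree = ∷ʳ-agree ν j
  νbalanced : Balanced n (suc l) (at ν)
  νbalanced = balanced-local n (suc l) (bounded-local (part-bounded ν Pν) agree)
                (λ k 1≤k k≤l → sym (agree k 1≤k k≤l))
                (λ i 1≤i i≤l → balanced i 1≤i (≤-trans i≤l (n≤1+n _)))
  1≤j : 1 ≤ j
  1≤j = subst (1 ≤_) (at-∷ʳ-last ν j) (proj₁ (proj₁ P (suc (suc l)) (s≤s z≤n) ≤-refl))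
  j≤last : j ≤ last ν
  j≤last = subst₂ _≤_ (at-∷ʳ-last ν j)
             (trans (sym (agree (suc l) (s≤s z≤n) ≤-refl)) (sym (last≡at ν)))
             (proj₂ P (suc l) (suc (suc l)) (s≤s z≤n) (n≤1+n _) ≤-refl)

balanced⇒InP : ∀ n l (μ : Vec ℕ (suc l)) → IsPart (suc l) (suc l + suc n ∸ 1) μ →
               Balanced n (suc l) (at μ) → InP (suc n) (suc l) μ
balanced⇒InP n zero (j ∷ []) P _ = base (proj₁ j-bounds) (proj₂ j-bounds)
  where
  j-bounds : (1 ≤ j) × (j ≤ suc n)
  j-bounds = proj₁ P 1 ≤-refl ≤-refl
balanced⇒InP n (suc l) μ P balanced with at μ 1 ≤? suc l + suc n ∸ 1
... | yes μ₁<max = fromD (snoc-InPd n l μ P balanced μ₁<max (balanced⇒InP n l))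
... | no μ₁≮max = subst (InP (suc n) L) (τ-involutive K μ (proj₁ P))
                    (fromτ (snoc-InPd n l ρ (mirror-IsPart μ ρ P μ∣ρ) ρbalanced ρ₁<max
                                      (balanced⇒InP n l)))
  where
  L K : ℕ
  L = suc (suc l)
  K = L + suc n ∸ 1
  ρ : Vec ℕ L
  ρ = τ K μ
  μ∣ρ : Mirror K L (at μ) (at ρ)
  μ∣ρ = τ-mirror K μ (proj₁ P)
  ρbalanced : Balanced n L (at ρ)
  ρbalanced = balanced-mirror n L (part-bounded μ P)
                (subst (λ K′ → Mirror K′ L (at μ) (at ρ)) (part-bound L n) μ∣ρ) balanced
  -- μ₁ is the maximum, so balance at 1 forces μ_L ≥ 2, i.e. ρ₁ = K + 1 - μ_L < K.
  μ₁≡max : at μ 1 ≡ n + L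
  μ₁≡max = trans (≤-antisym (proj₂ (proj₁ P 1 ≤-refl (s≤s z≤n))) (≰⇒> μ₁≮max)) (part-bound L n)
  1<μL : 1 < at μ L
  1<μL = proj₁ (balanced 1 ≤-refl (s≤s z≤n)) L μ₁≡max (s≤s (s≤s z≤n))
  ρ₁<max : at ρ 1 ≤ suc l + suc n ∸ 1
  ρ₁<max = ≤-pred (swap-< (trans (sym (μ∣ρ 1 L ≤-refl (s≤s z≤n) refl)) (+-comm (at ρ 1) (at μ L)))
                          1<μL)

mainTheorem4 : (ℓ m : ℕ) → 1 ≤ ℓ → 1 ≤ m → (μ : Vec ℕ ℓ) → IsPart ℓ (ℓ + m ∸ 1) μ →
    InP m ℓ μ ⇔
      (∀ i → 1 ≤ i → i ≤ ℓ →
        (tilde m μ i > i → tilde m μ (tilde m μ i) > i) ×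
        (tilde m μ i < i → tilde m μ (tilde m μ i) < i))
mainTheorem4 (suc l) (suc n) _ _ μ P = mk⇔
  (λ μ∈ i 1≤i i≤ℓ → to (balanced⇔tilde n (at μ) i) (InP⇒balanced μ∈ i 1≤i i≤ℓ))
  (λ tilde-cond → balanced⇒InP n l μ P
     (λ i 1≤i i≤ℓ → from (balanced⇔tilde n (at μ) i) (tilde-cond i 1≤i i≤ℓ)))
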